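{- Let $F$ be a field, $n\ge 0$, and let $p(x) = \sum_{k=0}^n a_k x^{n-k}$ and $q(x)=\sum_{j=0}^n c_j x^{n-j}$ be polynomials in $F[x]$ such that $p(x^2) = x^n q(x+x^{ -1})$. Then $c_j = 0$ for every odd $j$, and for every $0\le k\le n$, \[ a_k = a_{n-k} = \sum_{j=0}^{\min(k,n-k)} \binom{n-2j}{k-j} c_{2j}. \] -}

module Defs where

open import Level using (_⊔_)
open import Algebra.Bundles using (CommutativeRing)
open import Data.Nat using (ℕ; zero; suc; _∸_)
open import Data.List using (List; []; _∷_)
open import Data.Product using (∃)
open import Relation.Nullary using (¬_)
import Algebra.Definitions.RawMonoid as RM

-- A field: a commutative ring with 1 ≉ 0 in which every nonzero element
-- has a multiplicative inverse (agda-stdlib has no Field bundle).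
record Field (c ℓ : Level.Level) : Set (Level.suc (c ⊔ ℓ)) where
  field
    commutativeRing : CommutativeRing c ℓ
  open CommutativeRing commutativeRing public
  field
    1≉0     : ¬ (1# ≈ 0#)
    inverse : ∀ x → ¬ (x ≈ 0#) → ∃ λ y → x * y ≈ 1#

-- Polynomials over a field, as coefficient lists (lowest degree first),
-- together with the usual ring operations and substitution.
module Poly {c ℓ} (F : Field c ℓ) where
  open Field F renaming (_*_ to _·_; _+_ to _⊕_)

  -- n-fold sum  n × a = a + ... + a   (image of n : ℕ in F, times a)
  open RM +-rawMonoid public using (_×_)

  Polynomial : Set c
  Polynomial = List Carrier

  coeff : Polynomial → ℕ → Carrier
  coeff []       _       = 0#
  coeff (a ∷ _)  zero    = a
  coeff (_ ∷ as) (suc m) = coeff as m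

  infix 4 _≈ₚ_
  _≈ₚ_ : Polynomial → Polynomial → Set ℓ
  P ≈ₚ Q = ∀ m → coeff P m ≈ coeff Q m

  infixl 6 _+ₚ_
  _+ₚ_ : Polynomial → Polynomial → Polynomial
  []       +ₚ Q        = Q
  (a ∷ P)  +ₚ []       = a ∷ P
  (a ∷ P)  +ₚ (b ∷ Q)  = (a ⊕ b) ∷ (P +ₚ Q)

  infixr 7 _⋆_
  _⋆_ : Carrier → Polynomial → Polynomial
  a ⋆ []      = []
  a ⋆ (b ∷ P) = (a · b) ∷ (a ⋆ P)

  infixl 7 _*ₚ_
  _*ₚ_ : Polynomial → Polynomial → Polynomial
  []      *ₚ Q = []
  (a ∷ P) *ₚ Q = (a ⋆ Q) +ₚ (0# ∷ (P *ₚ Q))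

  constₚ : Carrier → Polynomial
  constₚ a = a ∷ []

  oneₚ : Polynomial
  oneₚ = constₚ 1#

  X : Polynomial
  X = 0# ∷ 1# ∷ []

  infixr 8 _^ₚ_
  _^ₚ_ : Polynomial → ℕ → Polynomial
  P ^ₚ zero  = oneₚ
  P ^ₚ suc k = P *ₚ (P ^ₚ k)

  _∘ₚ_ : Polynomial → Polynomial → Polynomial
  []      ∘ₚ G = []
  (a ∷ P) ∘ₚ G = constₚ a +ₚ (G *ₚ (P ∘ₚ G))

  Σ≤ : ℕ → (ℕ → Carrier) → Carrier
  Σ≤ zero    f = f 0
  Σ≤ (suc n) f = Σ≤ n f ⊕ f (suc n)

  Σₚ≤ : ℕ → (ℕ → Polynomial) → Polynomial
  Σₚ≤ zero    f = f 0
  Σₚ≤ (suc n) f = Σₚ≤ n f +ₚ f (suc n)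

  topPoly : ℕ → (ℕ → Carrier) → Polynomial
  topPoly n a = Σₚ≤ n (λ k → a k ⋆ (X ^ₚ (n ∸ k)))

  -- For q = Σ_{j=0}^{n} c_j y^{n-j}, the Laurent polynomial
  --   x^n q(x + x⁻¹) = Σ_j c_j x^n (x + x⁻¹)^{n-j} = Σ_j c_j x^j (x² + 1)^{n-j},
  -- which is an honest polynomial; this is its literal expansion.
  xⁿq[x+x⁻¹] : ℕ → (ℕ → Carrier) → Polynomial
  xⁿq[x+x⁻¹] n c =
    Σₚ≤ n (λ j → c j ⋆ ((X ^ₚ j) *ₚ (((X ^ₚ 2) +ₚ oneₚ) ^ₚ (n ∸ j))))

{-# OPTIONS --safe #-}
module Submission where

-- Write x^n q(x + x⁻¹) = Σ_j c_j T_j with T_j = x^j (1 + x²)^(n-j).  The coefficient of x^m in T_j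
-- is C(n-j, (m-j)/2) when m - j is even and nonnegative, and 0 otherwise.  The odd coefficients of
-- p(x²) vanish; at x^(2u+1) only odd j ≤ 2u+1 contribute, and T_(2u+1) with coefficient 1, so this
-- system is unitriangular and the odd c_j vanish by strong induction on u.  At x^(2i) only j = 2t
-- with t ≤ i contribute, and C(n-2t, i-t) = 0 once t > n-i, which gives
-- a_(n-i) = Σ_(t ≤ min(i, n-i)) C(n-2t, i-t) c_(2t).  This sum is invariant under i ↦ n-i since
-- C(n-2t, i-t) = C(n-2t, n-i-t), whence a_k = a_(n-k).

open import Defs
open import Data.Nat using (ℕ; _≤_; _∸_; _⊓_; _*_; suc)
open import Data.Nat.Combinatorics using (_C_)
open import Data.Product using (_×_)

open import Data.Nat using (zero; _+_; _<_; z≤n; s≤s; s≤s⁻¹; _≤?_)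
open import Data.Nat.Properties
  using (*-suc; +-suc; *-distribˡ-+; m+[n∸m]≡n; m+n∸m≡n; m+n∸n≡m; m∸[m∸n]≡n; m∸n≤m;
         ∸-+-assoc; ∸-monoˡ-<; m≤n+m; m≤n+m∸n; m≤n⇒m<n∨m≡n; m≤n⇒m≤1+n; <⇒≤; <⇒≢; ≤-refl;
         ≤-trans; <-cmp; <⇒≱; ≰⇒>; *-cancelˡ-≤; *-cancelˡ-<; *-monoʳ-<; +-monoʳ-<; +-mono-≤;
         ⊓-comm; ⊓-glb; m⊓n≤m; m⊓n≤n; module ≤-Reasoning)
  renaming (+-identityʳ to +-identityʳ-ℕ)
open import Data.Nat.Combinatorics using (nCk≡nC[n∸k]; nCk+nC[k+1]≡[n+1]C[k+1]; k>n⇒nCk≡0)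
open import Data.Nat.Induction using (<-rec)
open import Data.Nat.Tactic.RingSolver using (solve-∀)
open import Data.List using ([]; _∷_)
open import Data.Product using (_,_)
open import Data.Sum using (inj₁; inj₂)
open import Function.Base using (_∘_)
open import Relation.Binary.Definitions using (tri<; tri≈; tri>)
open import Relation.Binary.PropositionalEquality as ≡ using (_≡_; _≢_; refl; cong; cong₂)
open import Relation.Nullary using (contradiction; yes; no)
import Algebra.Properties.CommutativeSemigroup as CommutativeSemigroupProperties
import Algebra.Properties.Semiring.Mult as SemiringMult
import Relation.Binary.Reasoning.Setoid as SetoidReasoning

data EvenOrOdd : ℕ → Set where
  even : ∀ i → EvenOrOdd (2 * i)
  odd  : ∀ i → EvenOrOdd (suc (2 * i))

evenOrOdd : ∀ m → EvenOrOdd m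
evenOrOdd zero = even 0
evenOrOdd (suc m) with evenOrOdd m
... | even i = odd i
... | odd i  = ≡.subst EvenOrOdd (*-suc 2 i) (even (suc i))

2*n≡2*m+2*[n∸m] : ∀ {m n} → m ≤ n → 2 * n ≡ 2 * m + 2 * (n ∸ m)
2*n≡2*m+2*[n∸m] {m} {n} m≤n =
  ≡.trans (cong (2 *_) (≡.sym (m+[n∸m]≡n m≤n))) (*-distribˡ-+ 2 m (n ∸ m))

2*[m⊓[n∸m]]≤n : ∀ {m n} → m ≤ n → 2 * (m ⊓ (n ∸ m)) ≤ n
2*[m⊓[n∸m]]≤n {m} {n} m≤n = begin
  2 * M        ≡⟨ cong (M +_) (+-identityʳ-ℕ M) ⟩
  M + M        ≤⟨ +-mono-≤ (m⊓n≤m m (n ∸ m)) (m⊓n≤n m (n ∸ m)) ⟩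
  m + (n ∸ m)  ≡⟨ m+[n∸m]≡n m≤n ⟩
  n            ∎
  where
  open ≤-Reasoning
  M : ℕ
  M = m ⊓ (n ∸ m)

m⊓[n∸m]<t⇒n<m+t : ∀ {m n t} → m ⊓ (n ∸ m) < t → t ≤ m → n < m + t
m⊓[n∸m]<t⇒n<m+t {m} {n} {t} M<t t≤m = begin-strict
  n            ≤⟨ m≤n+m∸n n m ⟩
  m + (n ∸ m)  <⟨ +-monoʳ-< m n∸m<t ⟩
  m + t        ∎
  where
  open ≤-Reasoning
  n∸m<t : n ∸ m < t
  n∸m<t = ≰⇒> (λ t≤n∸m → <⇒≱ M<t (⊓-glb t≤m t≤n∸m))

[n∸2t]C[i∸t]≡0 : ∀ {n i t} → 2 * t ≤ n → n < i + t → (n ∸ 2 * t) C (i ∸ t) ≡ 0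
[n∸2t]C[i∸t]≡0 {n} {i} {t} 2t≤n n<i+t =
  k>n⇒nCk≡0 (≡.subst (n ∸ 2 * t <_) [i+t]∸2t≡i∸t (∸-monoˡ-< n<i+t 2t≤n))
  where
  open ≡.≡-Reasoning
  [i+t]∸2t≡i∸t : (i + t) ∸ 2 * t ≡ i ∸ t
  [i+t]∸2t≡i∸t = begin
    (i + t) ∸ (t + (t + 0))  ≡⟨ ∸-+-assoc (i + t) t (t + 0) ⟨
    (i + t) ∸ t ∸ (t + 0)    ≡⟨ cong₂ _∸_ (m+n∸n≡m i t) (+-identityʳ-ℕ t) ⟩
    i ∸ t                    ∎

[n∸2j]C[[n∸k]∸j]≡[n∸2j]C[k∸j] : ∀ {n k j} → k ≤ n → j ≤ k → j ≤ n ∸ k →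
                               (n ∸ 2 * j) C ((n ∸ k) ∸ j) ≡ (n ∸ 2 * j) C (k ∸ j)
[n∸2j]C[[n∸k]∸j]≡[n∸2j]C[k∸j] {n} {k} {j} k≤n j≤k j≤n∸k = begin
  (n ∸ 2 * j) C y          ≡⟨ cong (_C y) n∸2j≡x+y ⟩
  (x + y) C y              ≡⟨ nCk≡nC[n∸k] (m≤n+m y x) ⟩
  (x + y) C ((x + y) ∸ y)  ≡⟨ cong ((x + y) C_) (m+n∸n≡m x y) ⟩
  (x + y) C x              ≡⟨ cong (_C x) n∸2j≡x+y ⟨
  (n ∸ 2 * j) C x          ∎
  where
  open ≡.≡-Reasoning
  x y : ℕ
  x = k ∸ j
  y = (n ∸ k) ∸ j
  regroup : ∀ j x y → (j + x) + (j + y) ≡ 2 * j + (x + y)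
  regroup = solve-∀
  n∸2j≡x+y : n ∸ 2 * j ≡ x + y
  n∸2j≡x+y = begin
    n ∸ 2 * j                    ≡⟨ cong (_∸ 2 * j) (m+[n∸m]≡n k≤n) ⟨
    (k + (n ∸ k)) ∸ 2 * j        ≡⟨ cong (_∸ 2 * j) (cong₂ _+_ (m+[n∸m]≡n j≤k) (m+[n∸m]≡n j≤n∸k)) ⟨
    ((j + x) + (j + y)) ∸ 2 * j  ≡⟨ cong (_∸ 2 * j) (regroup j x y) ⟩
    (2 * j + (x + y)) ∸ 2 * j    ≡⟨ m+n∸m≡n (2 * j) (x + y) ⟩
    x + y                        ∎

module Coefficients {ℓ₁ ℓ₂} (F : Field ℓ₁ ℓ₂) where
  open Field F hiding (zero)
    renaming ( _*_ to _·_; _+_ to _⊕_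
             ; refl to ≈-refl; sym to ≈-sym; trans to ≈-trans; reflexive to ≈-reflexive )
  open Poly F renaming (_×_ to _×ₙ_)
  open SemiringMult semiring using (×-homo-+; ×-comm-*; ×-congʳ)
  open CommutativeSemigroupProperties +-commutativeSemigroup
    using () renaming (interchange to +-interchange)
  open SetoidReasoning setoid

  Σ≤-cong : ∀ N {f g : ℕ → Carrier} → (∀ t → t ≤ N → f t ≈ g t) → Σ≤ N f ≈ Σ≤ N g
  Σ≤-cong zero    f≈g = f≈g 0 z≤n
  Σ≤-cong (suc N) f≈g = +-cong (Σ≤-cong N (λ t t≤N → f≈g t (m≤n⇒m≤1+n t≤N))) (f≈g (suc N) ≤-refl)

  Σ≤-zero : ∀ N {f : ℕ → Carrier} → (∀ t → t ≤ N → f t ≈ 0#) → Σ≤ N f ≈ 0#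
  Σ≤-zero zero    f≈0 = f≈0 0 z≤n
  Σ≤-zero (suc N) f≈0 =
    ≈-trans (+-cong (Σ≤-zero N (λ t t≤N → f≈0 t (m≤n⇒m≤1+n t≤N))) (f≈0 (suc N) ≤-refl))
            (+-identityʳ 0#)

  Σ≤-truncate : ∀ {M} N (f : ℕ → Carrier) → M ≤ N → (∀ t → M < t → t ≤ N → f t ≈ 0#) →
                Σ≤ N f ≈ Σ≤ M f
  Σ≤-truncate zero    f z≤n _ = ≈-refl
  Σ≤-truncate {M} (suc N) f M≤1+N f≈0 with m≤n⇒m<n∨m≡n M≤1+N
  ... | inj₂ refl      = ≈-refl
  ... | inj₁ (s≤s M≤N) = begin
    Σ≤ N f ⊕ f (suc N)  ≈⟨ +-cong (Σ≤-truncate N f M≤N (λ t M<t t≤N → f≈0 t M<t (m≤n⇒m≤1+n t≤N)))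
                                  (f≈0 (suc N) (s≤s M≤N) ≤-refl) ⟩
    Σ≤ M f ⊕ 0#         ≈⟨ +-identityʳ _ ⟩
    Σ≤ M f              ∎

  Σ≤-single : ∀ N (f : ℕ → Carrier) {t} → t ≤ N → (∀ j → j ≤ N → j ≢ t → f j ≈ 0#) →
              Σ≤ N f ≈ f t
  Σ≤-single N f {t} t≤N f≈0 =
    ≈-trans (Σ≤-truncate N f t≤N (λ j t<j j≤N → f≈0 j j≤N (≡.≢-sym (<⇒≢ t<j))))
            (lastOnly t (λ j j<t → f≈0 j (≤-trans (<⇒≤ j<t) t≤N) (<⇒≢ j<t)))
    where
    lastOnly : ∀ s → (∀ j → j < s → f j ≈ 0#) → Σ≤ s f ≈ f s
    lastOnly zero    _   = ≈-refl
    lastOnly (suc s) f≈0 =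
      ≈-trans (+-congʳ (Σ≤-zero s (λ j j≤s → f≈0 j (s≤s j≤s)))) (+-identityˡ _)

  Σ≤-evens : ∀ M (f : ℕ → Carrier) → (∀ u → u < M → f (suc (2 * u)) ≈ 0#) →
             Σ≤ (2 * M) f ≈ Σ≤ M (λ t → f (2 * t))
  Σ≤-evens zero    f _   = ≈-refl
  Σ≤-evens (suc M) f f≈0 = begin
    Σ≤ (2 * suc M) f                              ≡⟨ cong (λ N → Σ≤ N f) (*-suc 2 M) ⟩
    (Σ≤ (2 * M) f ⊕ f (suc (2 * M))) ⊕ f (2 + 2 * M)
      ≈⟨ +-congʳ (+-cong (Σ≤-evens M f (λ u u<M → f≈0 u (m≤n⇒m≤1+n u<M))) (f≈0 M ≤-refl)) ⟩
    (Σ≤ M f₂ ⊕ 0#) ⊕ f (2 + 2 * M)                ≈⟨ +-congʳ (+-identityʳ _) ⟩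
    Σ≤ M f₂ ⊕ f (2 + 2 * M)                       ≡⟨ cong (λ k → Σ≤ M f₂ ⊕ f k) (*-suc 2 M) ⟨
    Σ≤ (suc M) f₂                                 ∎
    where
    f₂ : ℕ → Carrier
    f₂ t = f (2 * t)

  coeff-+ₚ : ∀ P Q m → coeff (P +ₚ Q) m ≈ coeff P m ⊕ coeff Q m
  coeff-+ₚ []      Q       m       = ≈-sym (+-identityˡ _)
  coeff-+ₚ (a ∷ P) []      m       = ≈-sym (+-identityʳ _)
  coeff-+ₚ (a ∷ P) (b ∷ Q) zero    = ≈-refl
  coeff-+ₚ (a ∷ P) (b ∷ Q) (suc m) = coeff-+ₚ P Q m

  coeff-⋆ : ∀ a P m → coeff (a ⋆ P) m ≈ a · coeff P m
  coeff-⋆ a []      m       = ≈-sym (zeroʳ a)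
  coeff-⋆ a (b ∷ P) zero    = ≈-refl
  coeff-⋆ a (b ∷ P) (suc m) = coeff-⋆ a P m

  coeff-Σₚ≤ : ∀ N f m → coeff (Σₚ≤ N f) m ≈ Σ≤ N (λ k → coeff (f k) m)
  coeff-Σₚ≤ zero    f m = ≈-refl
  coeff-Σₚ≤ (suc N) f m = ≈-trans (coeff-+ₚ (Σₚ≤ N f) (f (suc N)) m) (+-congʳ (coeff-Σₚ≤ N f m))

  coeff-∷*ₚ-zero : ∀ a P Q → coeff ((a ∷ P) *ₚ Q) 0 ≈ a · coeff Q 0
  coeff-∷*ₚ-zero a P Q =
    ≈-trans (coeff-+ₚ (a ⋆ Q) (0# ∷ P *ₚ Q) 0) (≈-trans (+-identityʳ _) (coeff-⋆ a Q 0))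

  coeff-∷*ₚ-suc : ∀ a P Q m →
                  coeff ((a ∷ P) *ₚ Q) (suc m) ≈ a · coeff Q (suc m) ⊕ coeff (P *ₚ Q) m
  coeff-∷*ₚ-suc a P Q m =
    ≈-trans (coeff-+ₚ (a ⋆ Q) (0# ∷ P *ₚ Q) (suc m)) (+-congʳ (coeff-⋆ a Q (suc m)))

  *ₚ-zeroˡ : ∀ P Q → P ≈ₚ [] → P *ₚ Q ≈ₚ []
  *ₚ-zeroˡ []      Q P≈0 m       = ≈-refl
  *ₚ-zeroˡ (a ∷ P) Q P≈0 zero    =
    ≈-trans (coeff-∷*ₚ-zero a P Q) (≈-trans (*-congʳ (P≈0 0)) (zeroˡ _))
  *ₚ-zeroˡ (a ∷ P) Q P≈0 (suc m) = begin
    coeff ((a ∷ P) *ₚ Q) (suc m)            ≈⟨ coeff-∷*ₚ-suc a P Q m ⟩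
    a · coeff Q (suc m) ⊕ coeff (P *ₚ Q) m
      ≈⟨ +-cong (≈-trans (*-congʳ (P≈0 0)) (zeroˡ _)) (*ₚ-zeroˡ P Q (λ k → P≈0 (suc k)) m) ⟩
    0# ⊕ 0#                                 ≈⟨ +-identityʳ 0# ⟩
    0#                                      ∎

  *ₚ-congʳ : ∀ P P' Q → P ≈ₚ P' → P *ₚ Q ≈ₚ P' *ₚ Q
  *ₚ-congʳ []      []        Q P≈P' m = ≈-refl
  *ₚ-congʳ []      (a' ∷ P') Q P≈P' m = ≈-sym (*ₚ-zeroˡ (a' ∷ P') Q (λ k → ≈-sym (P≈P' k)) m)
  *ₚ-congʳ (a ∷ P) []        Q P≈P' m = *ₚ-zeroˡ (a ∷ P) Q P≈P' m
  *ₚ-congʳ (a ∷ P) (a' ∷ P') Q P≈P' zero = begin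
    coeff ((a ∷ P) *ₚ Q) 0    ≈⟨ coeff-∷*ₚ-zero a P Q ⟩
    a · coeff Q 0             ≈⟨ *-congʳ (P≈P' 0) ⟩
    a' · coeff Q 0            ≈⟨ coeff-∷*ₚ-zero a' P' Q ⟨
    coeff ((a' ∷ P') *ₚ Q) 0  ∎
  *ₚ-congʳ (a ∷ P) (a' ∷ P') Q P≈P' (suc m) = begin
    coeff ((a ∷ P) *ₚ Q) (suc m)              ≈⟨ coeff-∷*ₚ-suc a P Q m ⟩
    a · coeff Q (suc m) ⊕ coeff (P *ₚ Q) m
      ≈⟨ +-cong (*-congʳ (P≈P' 0)) (*ₚ-congʳ P P' Q (λ k → P≈P' (suc k)) m) ⟩
    a' · coeff Q (suc m) ⊕ coeff (P' *ₚ Q) m  ≈⟨ coeff-∷*ₚ-suc a' P' Q m ⟨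
    coeff ((a' ∷ P') *ₚ Q) (suc m)            ∎

  *ₚ-distribʳ-+ₚ : ∀ P P' Q → (P +ₚ P') *ₚ Q ≈ₚ P *ₚ Q +ₚ P' *ₚ Q
  *ₚ-distribʳ-+ₚ []      P'       Q m       = ≈-refl
  *ₚ-distribʳ-+ₚ (a ∷ P) []       Q m       =
    ≈-sym (≈-trans (coeff-+ₚ ((a ∷ P) *ₚ Q) [] m) (+-identityʳ _))
  *ₚ-distribʳ-+ₚ (a ∷ P) (b ∷ P') Q zero    = begin
    coeff (((a ⊕ b) ∷ (P +ₚ P')) *ₚ Q) 0              ≈⟨ coeff-∷*ₚ-zero (a ⊕ b) (P +ₚ P') Q ⟩
    (a ⊕ b) · coeff Q 0                               ≈⟨ distribʳ _ a b ⟩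
    a · coeff Q 0 ⊕ b · coeff Q 0
      ≈⟨ +-cong (coeff-∷*ₚ-zero a P Q) (coeff-∷*ₚ-zero b P' Q) ⟨
    coeff ((a ∷ P) *ₚ Q) 0 ⊕ coeff ((b ∷ P') *ₚ Q) 0  ≈⟨ coeff-+ₚ ((a ∷ P) *ₚ Q) ((b ∷ P') *ₚ Q) 0 ⟨
    coeff ((a ∷ P) *ₚ Q +ₚ (b ∷ P') *ₚ Q) 0           ∎
  *ₚ-distribʳ-+ₚ (a ∷ P) (b ∷ P') Q (suc m) = begin
    coeff (((a ⊕ b) ∷ (P +ₚ P')) *ₚ Q) (suc m)     ≈⟨ coeff-∷*ₚ-suc (a ⊕ b) (P +ₚ P') Q m ⟩
    (a ⊕ b) · coeff Q (suc m) ⊕ coeff ((P +ₚ P') *ₚ Q) m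
      ≈⟨ +-cong (distribʳ _ a b)
                (≈-trans (*ₚ-distribʳ-+ₚ P P' Q m) (coeff-+ₚ (P *ₚ Q) (P' *ₚ Q) m)) ⟩
    (a · coeff Q (suc m) ⊕ b · coeff Q (suc m)) ⊕ (coeff (P *ₚ Q) m ⊕ coeff (P' *ₚ Q) m)
      ≈⟨ +-interchange _ _ _ _ ⟩
    (a · coeff Q (suc m) ⊕ coeff (P *ₚ Q) m) ⊕ (b · coeff Q (suc m) ⊕ coeff (P' *ₚ Q) m)
      ≈⟨ +-cong (coeff-∷*ₚ-suc a P Q m) (coeff-∷*ₚ-suc b P' Q m) ⟨
    coeff ((a ∷ P) *ₚ Q) (suc m) ⊕ coeff ((b ∷ P') *ₚ Q) (suc m)
      ≈⟨ coeff-+ₚ ((a ∷ P) *ₚ Q) ((b ∷ P') *ₚ Q) (suc m) ⟨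
    coeff ((a ∷ P) *ₚ Q +ₚ (b ∷ P') *ₚ Q) (suc m)  ∎

  oneₚ-*ₚ : ∀ P → oneₚ *ₚ P ≈ₚ P
  oneₚ-*ₚ P zero    = ≈-trans (coeff-∷*ₚ-zero 1# [] P) (*-identityˡ _)
  oneₚ-*ₚ P (suc m) = ≈-trans (coeff-∷*ₚ-suc 1# [] P m) (≈-trans (+-identityʳ _) (*-identityˡ _))

  0∷-*ₚ : ∀ P Q → (0# ∷ P) *ₚ Q ≈ₚ 0# ∷ (P *ₚ Q)
  0∷-*ₚ P Q zero    = ≈-trans (coeff-∷*ₚ-zero 0# P Q) (zeroˡ _)
  0∷-*ₚ P Q (suc m) =
    ≈-trans (coeff-∷*ₚ-suc 0# P Q m) (≈-trans (+-congʳ (zeroˡ _)) (+-identityˡ _))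

  X-*ₚ : ∀ P → X *ₚ P ≈ₚ 0# ∷ P
  X-*ₚ P zero    = 0∷-*ₚ oneₚ P zero
  X-*ₚ P (suc m) = ≈-trans (0∷-*ₚ oneₚ P (suc m)) (oneₚ-*ₚ P m)

  X^suc-*ₚ : ∀ j Q → X ^ₚ suc j *ₚ Q ≈ₚ 0# ∷ (X ^ₚ j *ₚ Q)
  X^suc-*ₚ j Q m =
    ≈-trans (*ₚ-congʳ (X *ₚ X ^ₚ j) (0# ∷ X ^ₚ j) Q (X-*ₚ (X ^ₚ j)) m) (0∷-*ₚ (X ^ₚ j) Q m)

  coeff-X^-diag : ∀ j → coeff (X ^ₚ j) j ≈ 1#
  coeff-X^-diag zero    = ≈-refl
  coeff-X^-diag (suc j) = ≈-trans (X-*ₚ (X ^ₚ j) (suc j)) (coeff-X^-diag j)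

  coeff-X^-off : ∀ {j m} → j ≢ m → coeff (X ^ₚ j) m ≈ 0#
  coeff-X^-off {zero}  {zero}  j≢m = contradiction refl j≢m
  coeff-X^-off {zero}  {suc m} _   = ≈-refl
  coeff-X^-off {suc j} {zero}  _   = X-*ₚ (X ^ₚ j) zero
  coeff-X^-off {suc j} {suc m} j≢m =
    ≈-trans (X-*ₚ (X ^ₚ j) (suc m)) (coeff-X^-off (j≢m ∘ cong suc))

  coeff-X^*ₚ-< : ∀ {j m} Q → m < j → coeff (X ^ₚ j *ₚ Q) m ≈ 0#
  coeff-X^*ₚ-< {suc j} {zero}  Q _         = X^suc-*ₚ j Q zero
  coeff-X^*ₚ-< {suc j} {suc m} Q (s≤s m<j) =
    ≈-trans (X^suc-*ₚ j Q (suc m)) (coeff-X^*ₚ-< Q m<j)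

  coeff-X^*ₚ-+ : ∀ j Q m → coeff (X ^ₚ j *ₚ Q) (j + m) ≈ coeff Q m
  coeff-X^*ₚ-+ zero    Q m = oneₚ-*ₚ Q m
  coeff-X^*ₚ-+ (suc j) Q m = ≈-trans (X^suc-*ₚ j Q (suc (j + m))) (coeff-X^*ₚ-+ j Q m)

  X² X²+1 : Polynomial
  X²   = X ^ₚ 2
  X²+1 = X² +ₚ oneₚ

  coeff-[X²+1]*ₚ : ∀ R m → coeff (X²+1 *ₚ R) m ≈ coeff (X² *ₚ R) m ⊕ coeff R m
  coeff-[X²+1]*ₚ R m =
    ≈-trans (*ₚ-distribʳ-+ₚ X² oneₚ R m)
            (≈-trans (coeff-+ₚ (X² *ₚ R) (oneₚ *ₚ R) m) (+-congˡ (oneₚ-*ₚ R m)))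

  coeff-[X²+1]*ₚ-<2 : ∀ R {m} → m < 2 → coeff (X²+1 *ₚ R) m ≈ coeff R m
  coeff-[X²+1]*ₚ-<2 R m<2 =
    ≈-trans (coeff-[X²+1]*ₚ R _) (≈-trans (+-congʳ (coeff-X^*ₚ-< R m<2)) (+-identityˡ _))

  coeff-[X²+1]*ₚ-2+ : ∀ R m → coeff (X²+1 *ₚ R) (2 + m) ≈ coeff R m ⊕ coeff R (2 + m)
  coeff-[X²+1]*ₚ-2+ R m = ≈-trans (coeff-[X²+1]*ₚ R (2 + m)) (+-congʳ (coeff-X^*ₚ-+ 2 R m))

  coeff-[X²+1]^-even : ∀ k i → coeff (X²+1 ^ₚ k) (2 * i) ≈ (k C i) ×ₙ 1#
  coeff-[X²+1]^-even zero    zero    = ≈-sym (+-identityʳ 1#)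
  coeff-[X²+1]^-even zero    (suc i) = ≈-refl
  coeff-[X²+1]^-even (suc k) zero    =
    ≈-trans (coeff-[X²+1]*ₚ-<2 (X²+1 ^ₚ k) (s≤s z≤n)) (coeff-[X²+1]^-even k 0)
  coeff-[X²+1]^-even (suc k) (suc i) = begin
    coeff (X²+1 *ₚ R) (2 * suc i)          ≡⟨ cong (coeff (X²+1 *ₚ R)) (*-suc 2 i) ⟩
    coeff (X²+1 *ₚ R) (2 + 2 * i)          ≈⟨ coeff-[X²+1]*ₚ-2+ R (2 * i) ⟩
    coeff R (2 * i) ⊕ coeff R (2 + 2 * i)  ≡⟨ cong (λ m → coeff R (2 * i) ⊕ coeff R m) (*-suc 2 i) ⟨
    coeff R (2 * i) ⊕ coeff R (2 * suc i)
      ≈⟨ +-cong (coeff-[X²+1]^-even k i) (coeff-[X²+1]^-even k (suc i)) ⟩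
    (k C i) ×ₙ 1# ⊕ (k C suc i) ×ₙ 1#      ≈⟨ ×-homo-+ 1# (k C i) (k C suc i) ⟨
    (k C i + k C suc i) ×ₙ 1#              ≡⟨ cong (_×ₙ 1#) (nCk+nC[k+1]≡[n+1]C[k+1] k i) ⟩
    (suc k C suc i) ×ₙ 1#                  ∎
    where
    R : Polynomial
    R = X²+1 ^ₚ k

  coeff-[X²+1]^-odd : ∀ k i → coeff (X²+1 ^ₚ k) (suc (2 * i)) ≈ 0#
  coeff-[X²+1]^-odd zero    i       = ≈-refl
  coeff-[X²+1]^-odd (suc k) zero    =
    ≈-trans (coeff-[X²+1]*ₚ-<2 (X²+1 ^ₚ k) ≤-refl) (coeff-[X²+1]^-odd k 0)
  coeff-[X²+1]^-odd (suc k) (suc i) = begin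
    coeff (X²+1 *ₚ R) (suc (2 * suc i))  ≡⟨ cong (coeff (X²+1 *ₚ R) ∘ suc) (*-suc 2 i) ⟩
    coeff (X²+1 *ₚ R) (2 + suc (2 * i))  ≈⟨ coeff-[X²+1]*ₚ-2+ R (suc (2 * i)) ⟩
    coeff R (suc (2 * i)) ⊕ coeff R (2 + suc (2 * i))
      ≡⟨ cong (λ m → coeff R (suc (2 * i)) ⊕ coeff R (suc m)) (*-suc 2 i) ⟨
    coeff R (suc (2 * i)) ⊕ coeff R (suc (2 * suc i))
      ≈⟨ +-cong (coeff-[X²+1]^-odd k i) (coeff-[X²+1]^-odd k (suc i)) ⟩
    0# ⊕ 0#                              ≈⟨ +-identityʳ 0# ⟩
    0#                                   ∎
    where
    R : Polynomial
    R = X²+1 ^ₚ k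

  coeff-∷∘ₚX²-<2 : ∀ a P {m} → m < 2 → coeff ((a ∷ P) ∘ₚ X²) m ≈ coeff (constₚ a) m
  coeff-∷∘ₚX²-<2 a P {m} m<2 =
    ≈-trans (coeff-+ₚ (constₚ a) (X² *ₚ (P ∘ₚ X²)) m)
            (≈-trans (+-congˡ (coeff-X^*ₚ-< (P ∘ₚ X²) m<2)) (+-identityʳ _))

  coeff-∷∘ₚX²-2+ : ∀ a P m → coeff ((a ∷ P) ∘ₚ X²) (2 + m) ≈ coeff (P ∘ₚ X²) m
  coeff-∷∘ₚX²-2+ a P m =
    ≈-trans (coeff-+ₚ (constₚ a) (X² *ₚ (P ∘ₚ X²)) (2 + m))
            (≈-trans (+-identityˡ _) (coeff-X^*ₚ-+ 2 (P ∘ₚ X²) m))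

  coeff-∘ₚX²-even : ∀ P i → coeff (P ∘ₚ X²) (2 * i) ≈ coeff P i
  coeff-∘ₚX²-even []      i       = ≈-refl
  coeff-∘ₚX²-even (a ∷ P) zero    = coeff-∷∘ₚX²-<2 a P (s≤s z≤n)
  coeff-∘ₚX²-even (a ∷ P) (suc i) =
    ≈-trans (≈-reflexive (cong (coeff ((a ∷ P) ∘ₚ X²)) (*-suc 2 i)))
            (≈-trans (coeff-∷∘ₚX²-2+ a P (2 * i)) (coeff-∘ₚX²-even P i))

  coeff-∘ₚX²-odd : ∀ P i → coeff (P ∘ₚ X²) (suc (2 * i)) ≈ 0#
  coeff-∘ₚX²-odd []      i       = ≈-refl
  coeff-∘ₚX²-odd (a ∷ P) zero    = coeff-∷∘ₚX²-<2 a P ≤-refl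
  coeff-∘ₚX²-odd (a ∷ P) (suc i) =
    ≈-trans (≈-reflexive (cong (coeff ((a ∷ P) ∘ₚ X²) ∘ suc) (*-suc 2 i)))
            (≈-trans (coeff-∷∘ₚX²-2+ a P (suc (2 * i))) (coeff-∘ₚX²-odd P i))

  coeff-topPoly : ∀ n a {i} → i ≤ n → coeff (topPoly n a) i ≈ a (n ∸ i)
  coeff-topPoly n a {i} i≤n = begin
    coeff (topPoly n a) i                     ≈⟨ coeff-Σₚ≤ n _ i ⟩
    Σ≤ n (λ k → coeff (a k ⋆ X ^ₚ (n ∸ k)) i) ≈⟨ Σ≤-single n _ (m∸n≤m n i) off ⟩
    coeff (a (n ∸ i) ⋆ X ^ₚ (n ∸ (n ∸ i))) i  ≈⟨ coeff-⋆ (a (n ∸ i)) (X ^ₚ (n ∸ (n ∸ i))) i ⟩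
    a (n ∸ i) · coeff (X ^ₚ (n ∸ (n ∸ i))) i
      ≡⟨ cong (λ j → a (n ∸ i) · coeff (X ^ₚ j) i) (m∸[m∸n]≡n i≤n) ⟩
    a (n ∸ i) · coeff (X ^ₚ i) i              ≈⟨ *-congˡ (coeff-X^-diag i) ⟩
    a (n ∸ i) · 1#                            ≈⟨ *-identityʳ _ ⟩
    a (n ∸ i)                                 ∎
    where
    off : ∀ k → k ≤ n → k ≢ n ∸ i → coeff (a k ⋆ X ^ₚ (n ∸ k)) i ≈ 0#
    off k k≤n k≢n∸i =
      ≈-trans (coeff-⋆ (a k) (X ^ₚ (n ∸ k)) i) (≈-trans (*-congˡ (coeff-X^-off n∸k≢i)) (zeroʳ _))
      where
      n∸k≢i : n ∸ k ≢ i
      n∸k≢i n∸k≡i = k≢n∸i (≡.trans (≡.sym (m∸[m∸n]≡n k≤n)) (cong (n ∸_) n∸k≡i))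

  module _ (n : ℕ) (c : ℕ → Carrier) where

    summand : ℕ → ℕ → Carrier
    summand m j = c j · coeff (X ^ₚ j *ₚ X²+1 ^ₚ (n ∸ j)) m

    coeff-xⁿq[x+x⁻¹] : ∀ m → coeff (xⁿq[x+x⁻¹] n c) m ≈ Σ≤ n (summand m)
    coeff-xⁿq[x+x⁻¹] m =
      ≈-trans (coeff-Σₚ≤ n _ m) (Σ≤-cong n (λ j _ → coeff-⋆ (c j) (X ^ₚ j *ₚ X²+1 ^ₚ (n ∸ j)) m))

    summand-< : ∀ {m j} → m < j → summand m j ≈ 0#
    summand-< m<j = ≈-trans (*-congˡ (coeff-X^*ₚ-< _ m<j)) (zeroʳ _)

    summand-diag : ∀ j → summand j j ≈ c j
    summand-diag j = begin
      c j · coeff T j                  ≡⟨ cong (λ m → c j · coeff T m) (+-identityʳ-ℕ j) ⟨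
      c j · coeff T (j + 2 * 0)        ≈⟨ *-congˡ (coeff-X^*ₚ-+ j (X²+1 ^ₚ (n ∸ j)) 0) ⟩
      c j · coeff (X²+1 ^ₚ (n ∸ j)) 0
        ≈⟨ *-congˡ (≈-trans (coeff-[X²+1]^-even (n ∸ j) 0) (+-identityʳ 1#)) ⟩
      c j · 1#                         ≈⟨ *-identityʳ (c j) ⟩
      c j                              ∎
      where
      T : Polynomial
      T = X ^ₚ j *ₚ X²+1 ^ₚ (n ∸ j)

    summand-odd-even : ∀ {u v} → v ≤ u → summand (suc (2 * u)) (2 * v) ≈ 0#
    summand-odd-even {u} {v} v≤u = begin
      c (2 * v) · coeff T (suc (2 * u))                ≡⟨ cong (λ m → c (2 * v) · coeff T m) index ⟩
      c (2 * v) · coeff T (2 * v + suc (2 * (u ∸ v)))  ≈⟨ *-congˡ (coeff-X^*ₚ-+ (2 * v) _ _) ⟩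
      c (2 * v) · coeff (X²+1 ^ₚ (n ∸ 2 * v)) (suc (2 * (u ∸ v)))
        ≈⟨ *-congˡ (coeff-[X²+1]^-odd (n ∸ 2 * v) (u ∸ v)) ⟩
      c (2 * v) · 0#                                   ≈⟨ zeroʳ _ ⟩
      0#                                               ∎
      where
      T : Polynomial
      T = X ^ₚ (2 * v) *ₚ X²+1 ^ₚ (n ∸ 2 * v)
      index : suc (2 * u) ≡ 2 * v + suc (2 * (u ∸ v))
      index = ≡.trans (cong suc (2*n≡2*m+2*[n∸m] v≤u)) (≡.sym (+-suc (2 * v) (2 * (u ∸ v))))

    summand-even-even : ∀ {i t} → t ≤ i →
                        summand (2 * i) (2 * t) ≈ ((n ∸ 2 * t) C (i ∸ t)) ×ₙ c (2 * t)
    summand-even-even {i} {t} t≤i = begin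
      c (2 * t) · coeff T (2 * i)
        ≡⟨ cong (λ m → c (2 * t) · coeff T m) (2*n≡2*m+2*[n∸m] t≤i) ⟩
      c (2 * t) · coeff T (2 * t + 2 * (i ∸ t))  ≈⟨ *-congˡ (coeff-X^*ₚ-+ (2 * t) _ _) ⟩
      c (2 * t) · coeff (X²+1 ^ₚ (n ∸ 2 * t)) (2 * (i ∸ t))
        ≈⟨ *-congˡ (coeff-[X²+1]^-even (n ∸ 2 * t) (i ∸ t)) ⟩
      c (2 * t) · (B ×ₙ 1#)                      ≈⟨ ×-comm-* B (c (2 * t)) 1# ⟩
      B ×ₙ (c (2 * t) · 1#)                      ≈⟨ ×-congʳ B (*-identityʳ _) ⟩
      B ×ₙ c (2 * t)                             ∎
      where
      T : Polynomial
      T = X ^ₚ (2 * t) *ₚ X²+1 ^ₚ (n ∸ 2 * t)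
      B : ℕ
      B = (n ∸ 2 * t) C (i ∸ t)

    c-odd≈0 : (∀ u → suc (2 * u) ≤ n → coeff (xⁿq[x+x⁻¹] n c) (suc (2 * u)) ≈ 0#) →
              ∀ u → suc (2 * u) ≤ n → c (suc (2 * u)) ≈ 0#
    c-odd≈0 xⁿq-odd≈0 = <-rec _ step
      where
      step : ∀ u → (∀ {v} → v < u → suc (2 * v) ≤ n → c (suc (2 * v)) ≈ 0#) →
             suc (2 * u) ≤ n → c (suc (2 * u)) ≈ 0#
      step u ih m≤n = begin
        c m                       ≈⟨ summand-diag m ⟨
        summand m m               ≈⟨ Σ≤-single n (summand m) m≤n off ⟨
        Σ≤ n (summand m)          ≈⟨ coeff-xⁿq[x+x⁻¹] m ⟨
        coeff (xⁿq[x+x⁻¹] n c) m  ≈⟨ xⁿq-odd≈0 u m≤n ⟩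
        0#                        ∎
        where
        m : ℕ
        m = suc (2 * u)
        below : ∀ j → j < m → j ≤ n → summand m j ≈ 0#
        below j j<m j≤n with evenOrOdd j
        ... | even v = summand-odd-even {u} {v} (*-cancelˡ-≤ 2 (s≤s⁻¹ j<m))
        ... | odd v  = ≈-trans (*-congʳ (ih (*-cancelˡ-< 2 v u (s≤s⁻¹ j<m)) j≤n)) (zeroˡ _)
        off : ∀ j → j ≤ n → j ≢ m → summand m j ≈ 0#
        off j j≤n j≢m with <-cmp j m
        ... | tri< j<m _ _ = below j j<m j≤n
        ... | tri≈ _ j≡m _ = contradiction j≡m j≢m
        ... | tri> _ _ m<j = summand-< m<j

    binomialSum : ℕ → Carrier
    binomialSum k = Σ≤ (k ⊓ (n ∸ k)) (λ j → ((n ∸ 2 * j) C (k ∸ j)) ×ₙ c (2 * j))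

    coeff-xⁿq[x+x⁻¹]-even : (∀ u → suc (2 * u) ≤ n → c (suc (2 * u)) ≈ 0#) →
                            ∀ {i} → i ≤ n → coeff (xⁿq[x+x⁻¹] n c) (2 * i) ≈ binomialSum i
    coeff-xⁿq[x+x⁻¹]-even c-odd {i} i≤n = begin
      coeff (xⁿq[x+x⁻¹] n c) (2 * i)        ≈⟨ coeff-xⁿq[x+x⁻¹] (2 * i) ⟩
      Σ≤ n (summand (2 * i))                ≈⟨ Σ≤-truncate n _ 2M≤n beyond ⟩
      Σ≤ (2 * M) (summand (2 * i))
        ≈⟨ Σ≤-evens M _ (λ u u<M → odd-summand {u} (≤-trans (*-monoʳ-< 2 u<M) 2M≤n)) ⟩
      Σ≤ M (λ t → summand (2 * i) (2 * t))
        ≈⟨ Σ≤-cong M (λ t t≤M → summand-even-even {i} {t} (≤-trans t≤M (m⊓n≤m i (n ∸ i)))) ⟩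
      binomialSum i                         ∎
      where
      M : ℕ
      M = i ⊓ (n ∸ i)
      2M≤n : 2 * M ≤ n
      2M≤n = 2*[m⊓[n∸m]]≤n i≤n
      odd-summand : ∀ {u} → suc (2 * u) ≤ n → summand (2 * i) (suc (2 * u)) ≈ 0#
      odd-summand {u} 1+2u≤n = ≈-trans (*-congʳ (c-odd u 1+2u≤n)) (zeroˡ _)
      beyond : ∀ j → 2 * M < j → j ≤ n → summand (2 * i) j ≈ 0#
      beyond j 2M<j j≤n with evenOrOdd j
      ... | odd u  = odd-summand {u} j≤n
      ... | even t with t ≤? i
      ...   | no t≰i  = summand-< (*-monoʳ-< 2 (≰⇒> t≰i))
      ...   | yes t≤i = ≈-trans (summand-even-even {i} {t} t≤i) (≈-reflexive (cong (_×ₙ c (2 * t))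
                          ([n∸2t]C[i∸t]≡0 {n} {i} {t} j≤n n<i+t)))
        where
        n<i+t : n < i + t
        n<i+t = m⊓[n∸m]<t⇒n<m+t (*-cancelˡ-< 2 M t 2M<j) t≤i

    binomialSum-reflect : ∀ {k} → k ≤ n → binomialSum (n ∸ k) ≈ binomialSum k
    binomialSum-reflect {k} k≤n = begin
      Σ≤ ((n ∸ k) ⊓ (n ∸ (n ∸ k))) (term (n ∸ k))  ≡⟨ cong (λ M → Σ≤ M (term (n ∸ k))) bound ⟩
      Σ≤ (k ⊓ (n ∸ k)) (term (n ∸ k))              ≈⟨ Σ≤-cong (k ⊓ (n ∸ k)) reflect ⟩
      Σ≤ (k ⊓ (n ∸ k)) (term k)                    ∎
      where
      term : ℕ → ℕ → Carrier
      term k j = ((n ∸ 2 * j) C (k ∸ j)) ×ₙ c (2 * j)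
      bound : (n ∸ k) ⊓ (n ∸ (n ∸ k)) ≡ k ⊓ (n ∸ k)
      bound = ≡.trans (cong ((n ∸ k) ⊓_) (m∸[m∸n]≡n k≤n)) (⊓-comm (n ∸ k) k)
      reflect : ∀ j → j ≤ k ⊓ (n ∸ k) → term (n ∸ k) j ≈ term k j
      reflect j j≤M = ≈-reflexive (cong (_×ₙ c (2 * j))
        ([n∸2j]C[[n∸k]∸j]≡[n∸2j]C[k∸j] k≤n (≤-trans j≤M (m⊓n≤m k _)) (≤-trans j≤M (m⊓n≤n k _))))

proposition2p8 : ∀ {ℓ₁ ℓ₂} (F : Field ℓ₁ ℓ₂) →
    let open Field F hiding (_*_) in
    let open Poly F renaming (_×_ to _×ₙ_) in
    (n : ℕ) (a c : ℕ → Carrier) →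
    (topPoly n a ∘ₚ (X ^ₚ 2)) ≈ₚ xⁿq[x+x⁻¹] n c →
    (∀ m → suc (2 * m) ≤ n → c (suc (2 * m)) ≈ 0#)
    × (∀ k → k ≤ n →
         (a k ≈ a (n ∸ k))
         × (a k ≈ Σ≤ (k ⊓ (n ∸ k)) (λ j → ((n ∸ 2 * j) C (k ∸ j)) ×ₙ c (2 * j))))
proposition2p8 F n a c p[x²]≈xⁿq[x+x⁻¹] =
  c-odd , λ k k≤n → ≈-trans (a≈binomialSum k≤n) (≈-sym (a[n∸i]≈binomialSum k≤n)) , a≈binomialSum k≤n
  where
  open Field F using (_≈_; 0#; setoid) renaming (sym to ≈-sym; trans to ≈-trans)
  open Poly F using (coeff; topPoly; xⁿq[x+x⁻¹]; _∘ₚ_)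
  open Coefficients F
  open SetoidReasoning setoid

  c-odd : ∀ u → suc (2 * u) ≤ n → c (suc (2 * u)) ≈ 0#
  c-odd = c-odd≈0 n c (λ u _ →
    ≈-trans (≈-sym (p[x²]≈xⁿq[x+x⁻¹] (suc (2 * u)))) (coeff-∘ₚX²-odd (topPoly n a) u))

  a[n∸i]≈binomialSum : ∀ {i} → i ≤ n → a (n ∸ i) ≈ binomialSum n c i
  a[n∸i]≈binomialSum {i} i≤n = begin
    a (n ∸ i)                          ≈⟨ coeff-topPoly n a i≤n ⟨
    coeff (topPoly n a) i              ≈⟨ coeff-∘ₚX²-even (topPoly n a) i ⟨
    coeff (topPoly n a ∘ₚ X²) (2 * i)  ≈⟨ p[x²]≈xⁿq[x+x⁻¹] (2 * i) ⟩
    coeff (xⁿq[x+x⁻¹] n c) (2 * i)     ≈⟨ coeff-xⁿq[x+x⁻¹]-even n c c-odd i≤n ⟩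
    binomialSum n c i                  ∎

  a≈binomialSum : ∀ {k} → k ≤ n → a k ≈ binomialSum n c k
  a≈binomialSum {k} k≤n = begin
    a k                      ≡⟨ cong a (m∸[m∸n]≡n k≤n) ⟨
    a (n ∸ (n ∸ k))          ≈⟨ a[n∸i]≈binomialSum (m∸n≤m n k) ⟩
    binomialSum n c (n ∸ k)  ≈⟨ binomialSum-reflect n c k≤n ⟩
    binomialSum n c k        ∎
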